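{- Let $k,m\in\mathbb{N}$ and let $G$ be an ordered graph with irreducible block decomposition $(G_1,\ldots,G_m)$. If $|\{i\in[m]:G_i\notin\mathcal{J}\}|\geqslant k$, then $S_n(G)\geqslant 2^{n-1}$ for every $n\leqslant k$.
   Context: An ordered graph of order $n$ is a graph on vertex set $[n]$ with the natural order. A pair of vertices $u<v$ separates the edges of an ordered graph if every edge $ij$ with $i<j$ has $j\leqslant u$ or $v\leqslant i$; the graph is irreducible if no pair separates its edges. The irreducible block decomposition of $G$ is the list $(G_1,\dots,G_m)$ of ordered graphs induced, from left to right, by the unique partition of $V(G)$ into intervals of consecutive vertices each inducing an irreducible graph, with no edges between different intervals. $S_n(G)$ is the number of distinct (non-isomorphic as ordered graphs) induced ordered subgraphs of $G$ of order $n$. For $n\in\mathbb{N}$: $J^{(n)}_1=K_n$; $J^{(n)}_2$ has vertex set $[n]$ and edge set $\{1n\}$ (empty if $n=1$); $J^{(n)}_3$ has edge set $\{1i:i\in[2,n]\}$; $J^{(n)}_4$ has edge set $\{in:i\in[n-1]\}$; $L^{(n)}$ has edge set $\{i(i+1):i\in[n-1]\}$; $Q_1$ on $[4]$ has edges $\{13,24\}$; $Q_2$ on $[4]$ has edges $\{14,23\}$. $\mathcal{J}$ is the set consisting of all $J^{(n)}_i$ ($i\in[4]$, $n\in\mathbb{N}$), all $L^{(n)}$ ($n\in\mathbb{N}$), $Q_1$ and $Q_2$. -}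

module Defs where

open import Data.Nat using (ℕ; zero; suc; _+_; _∸_; _≤_; _<_; _≡ᵇ_)
open import Data.Bool using (Bool; true; false; _∧_; _∨_)
import Data.Bool.Properties as BoolP
open import Data.List using (List; []; _∷_; map; _++_; length; upTo; deduplicate)
import Data.List.Properties as ListP
open import Data.List.Relation.Unary.All using (All)
open import Data.List.Relation.Binary.Sublist.Propositional using (_⊆_)
open import Data.Product using (Σ; _×_; _,_; ∃)
open import Data.Sum using (_⊎_)
open import Relation.Binary.PropositionalEquality using (_≡_)
open import Relation.Nullary using (¬_)

-- An ordered graph of order n: vertices 0,…,n-1 (vertex i here is vertex i+1
-- of the paper), with the natural order.  For i < j < n, ij is an edge iff
-- adj i j ≡ true; values of adj outside { (i,j) : i < j < n } are irrelevant.
record OGraph : Set where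
  constructor mkOGraph
  field
    order : ℕ
    adj   : ℕ → ℕ → Bool
open OGraph public

Edge : OGraph → ℕ → ℕ → Set
Edge G i j = i < j × j < order G × adj G i j ≡ true

-- isomorphism of ordered graphs (the only order-preserving bijection [n]→[n]
-- is the identity, so this is: same order and same edge set)
_≅_ : OGraph → OGraph → Set
G ≅ H = Σ (order G ≡ order H) λ _ →
          ∀ i j → i < j → j < order G → adj G i j ≡ adj H i j

Separates : OGraph → ℕ → ℕ → Set
Separates G u v = u < v × v < order G ×
  (∀ i j → Edge G i j → j ≤ u ⊎ v ≤ i)

Irreducible : OGraph → Set
Irreducible G = ∀ u v → ¬ Separates G u v

interval : OGraph → ℕ → ℕ → OGraph
interval G o s = mkOGraph s (λ i j → adj G (o + i) (o + j))

IsBlockDecomp : OGraph → ℕ → List ℕ → Set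
IsBlockDecomp G o [] = o ≡ order G
IsBlockDecomp G o (b ∷ bs) =
  1 ≤ b × Irreducible (interval G o b) ×
  (∀ i j → o ≤ i → i < o + b → o + b ≤ j → ¬ Edge G i j) ×
  IsBlockDecomp G (o + b) bs

blocks : OGraph → ℕ → List ℕ → List OGraph
blocks G o [] = []
blocks G o (b ∷ bs) = interval G o b ∷ blocks G (o + b) bs

IsIrreducibleBlockDecomposition : OGraph → List OGraph → Set
IsIrreducibleBlockDecomposition G Gs =
  Σ (List ℕ) λ bs → IsBlockDecomp G 0 bs × Gs ≡ blocks G 0 bs

isLast : ℕ → ℕ → Bool
isLast n j = (suc j) ≡ᵇ n

J₁ J₂ J₃ J₄ L : ℕ → OGraph
J₁ n = mkOGraph n (λ i j → true)
J₂ n = mkOGraph n (λ i j → (i ≡ᵇ 0) ∧ isLast n j)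
J₃ n = mkOGraph n (λ i j → i ≡ᵇ 0)
J₄ n = mkOGraph n (λ i j → isLast n j)
L  n = mkOGraph n (λ i j → j ≡ᵇ suc i)

Q₁ Q₂ : OGraph
Q₁ = mkOGraph 4 (λ i j → ((i ≡ᵇ 0) ∧ (j ≡ᵇ 2)) ∨ ((i ≡ᵇ 1) ∧ (j ≡ᵇ 3)))
Q₂ = mkOGraph 4 (λ i j → ((i ≡ᵇ 0) ∧ (j ≡ᵇ 3)) ∨ ((i ≡ᵇ 1) ∧ (j ≡ᵇ 2)))

_∈𝒥 : OGraph → Set
H ∈𝒥 = ∃ λ n → (H ≅ J₁ n) ⊎ (H ≅ J₂ n) ⊎ (H ≅ J₃ n) ⊎ (H ≅ J₄ n) ⊎ (H ≅ L n)
        ⊎ (H ≅ Q₁) ⊎ (H ≅ Q₂)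

choose : ℕ → List ℕ → List (List ℕ)
choose zero xs = [] ∷ []
choose (suc n) [] = []
choose (suc n) (x ∷ xs) = map (x ∷_) (choose n xs) ++ choose (suc n) xs

-- Two induced ordered subgraphs of the same order are isomorphic iff
-- their codes are equal.
code : (ℕ → ℕ → Bool) → List ℕ → List Bool
code a [] = []
code a (v ∷ vs) = map (a v) vs ++ code a vs

S : ℕ → OGraph → ℕ
S n G = length (deduplicate (ListP.≡-dec BoolP._≟_)
                  (map (code (adj G)) (choose n (upTo (order G)))))

-- In an irreducible block H ∉ 𝒥 there are "pieces", vertex sets inducing irreducible ordered
-- graphs: a vertex, an edge, and either two triples with different induced patterns or one
-- triple and two quadruples with different induced patterns.  (If all irreducible triples of H
-- induce the same pattern, a case analysis on that pattern shows that H ∈ 𝒥 unless the second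
-- alternative occurs.)  Choose a piece in each of the first blocks outside 𝒥, from left to
-- right, until n vertices are chosen.  Different choices induce non-isomorphic ordered graphs:
-- in the first block where they differ, either the two pieces have the same size and different
-- patterns, or the cut right after the shorter piece is crossed by an edge of the longer,
-- irreducible, piece but by no edge on the side of the shorter one, whose next vertices lie in
-- later blocks.  With piece sizes 1, 2, 3, 3 (or 1, 2, 3, 4, 4) the number f(n) of choices
-- satisfies f(n) ≥ f(n−1) + f(n−2) + 2f(n−3) (or f(n) ≥ f(n−1) + f(n−2) + f(n−3) + 2f(n−4)),
-- hence f(n) ≥ 2^(n−1) whenever there are at least n blocks outside 𝒥.

module Submission where

open import Defs
open import Data.Bool using (Bool; true; false)
import Data.Bool.Properties as Bool
open import Data.Empty using (⊥; ⊥-elim)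
open import Data.List using (List; []; _∷_; map; _++_; length; upTo; applyUpTo)
import Data.List.Properties as List
open import Data.List.Membership.Propositional using (_∈_; _─_)
open import Data.List.Membership.Propositional.Properties using (∈-deduplicate⁺; ∈-++⁺ˡ; ∈-++⁺ʳ; ∈-map⁺)
open import Data.List.Relation.Binary.Sublist.Propositional using (_⊆_; []; _∷_; _∷ʳ_; minimum)
open import Data.List.Relation.Unary.All as All using (All; []; _∷_)
import Data.List.Relation.Unary.All.Properties as All
open import Data.List.Relation.Unary.AllPairs as AllPairs using (AllPairs; []; _∷_)
import Data.List.Relation.Unary.AllPairs.Properties as AllPairs
open import Data.List.Relation.Unary.Any using (here; there; index)
open import Data.List.Relation.Unary.Unique.Propositional using (Unique)
open import Data.Nat using (ℕ; zero; suc; _+_; _*_; _∸_; _≤_; _<_; _^_; z≤n; s≤s; _≤?_)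
open import Data.Nat.Tactic.RingSolver using (solve-∀)
open import Data.Nat.Properties
open import Data.Product using (Σ; _×_; _,_; ∃; ∃₂; proj₁; proj₂)
open import Data.Product.Properties using (≡-dec)
open import Data.Sum using (_⊎_; inj₁; inj₂; [_,_]′)
open import Relation.Binary.PropositionalEquality
  using (_≡_; _≢_; refl; sym; trans; cong; cong₂; subst; module ≡-Reasoning)
open import Relation.Binary using (DecidableEquality; tri<; tri≈; tri>)
open import Relation.Nullary using (¬_; Dec; yes; no; ¬?; _×-dec_; _⊎-dec_)
open import Relation.Nullary.Decidable using (dec-true; dec-false; decidable-stable)

private
  variable
    X : Set
    x y : X

-- Vertex lists and the patterns they induce

false≢true : false ≢ true
false≢true ()

false-if-refuted : ∀ {b} → (b ≡ true → b ≡ false) → b ≡ false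
false-if-refuted {false} _ = refl
false-if-refuted {true}  f = f refl

infixl 9 _!_
_!_ : List ℕ → ℕ → ℕ
[]       ! _     = 0
(x ∷ xs) ! zero  = x
(x ∷ xs) ! suc i = xs ! i

!-++ˡ : ∀ (xs ys : List ℕ) {i} → i < length xs → (xs ++ ys) ! i ≡ xs ! i
!-++ˡ (x ∷ xs) ys {zero}  _       = refl
!-++ˡ (x ∷ xs) ys {suc i} (s≤s p) = !-++ˡ xs ys p

!-++ʳ : ∀ (xs ys : List ℕ) i → (xs ++ ys) ! (length xs + i) ≡ ys ! i
!-++ʳ []       ys i = refl
!-++ʳ (x ∷ xs) ys i = !-++ʳ xs ys i

!-map-+ : ∀ o (xs : List ℕ) {i} → i < length xs → map (o +_) xs ! i ≡ o + xs ! i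
!-map-+ o (x ∷ xs) {zero}  _       = refl
!-map-+ o (x ∷ xs) {suc i} (s≤s p) = !-map-+ o xs p

All-! : ∀ {P : ℕ → Set} {xs} → All P xs → ∀ {i} → i < length xs → P (xs ! i)
All-! (px ∷ _)  {zero}  _       = px
All-! (_ ∷ pxs) {suc i} (s≤s p) = All-! pxs p

++-cancel-≡length : ∀ (xs ys : List X) {us vs} → length xs ≡ length ys →
                    xs ++ us ≡ ys ++ vs → xs ≡ ys × us ≡ vs
++-cancel-≡length []       []       _   eq = refl , eq
++-cancel-≡length (x ∷ xs) (y ∷ ys) len eq
  with refl , eq′ ← List.∷-injective eq
  with refl , eq″ ← ++-cancel-≡length xs ys (suc-injective len) eq′ = refl , eq″

map-≡⇒!-≡ : ∀ {f g : ℕ → X} xs ys → map f xs ≡ map g ys →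
            ∀ {i} → i < length xs → f (xs ! i) ≡ g (ys ! i)
map-≡⇒!-≡ (x ∷ xs) (y ∷ ys) eq {zero}  _       = List.∷-injectiveˡ eq
map-≡⇒!-≡ (x ∷ xs) (y ∷ ys) eq {suc i} (s≤s p) = map-≡⇒!-≡ xs ys (List.∷-injectiveʳ eq) p

induced : (ℕ → ℕ → Bool) → List ℕ → ℕ → ℕ → Bool
induced A vs i j = A (vs ! i) (vs ! j)

PatternsDiffer : (ℕ → ℕ → Bool) → List ℕ → List ℕ → Set
PatternsDiffer A vs ws =
  ∃₂ λ i j → i < j × j < length vs × induced A vs i j ≢ induced A ws i j

code-≡⇒induced-≡ : ∀ (A : ℕ → ℕ → Bool) vs ws → length vs ≡ length ws → code A vs ≡ code A ws →
                   ∀ {i j} → i < j → j < length vs → induced A vs i j ≡ induced A ws i j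
code-≡⇒induced-≡ A (v ∷ vs) (w ∷ ws) len eq {i} {suc j} i<j (s≤s j<) = go i i<j
  where
  len′ = suc-injective len
  rows = ++-cancel-≡length (map (A v) vs) (map (A w) ws)
           (trans (List.length-map (A v) vs) (trans len′ (sym (List.length-map (A w) ws)))) eq
  go : ∀ i → i < suc j → induced A (v ∷ vs) i (suc j) ≡ induced A (w ∷ ws) i (suc j)
  go zero    _       = map-≡⇒!-≡ vs ws (proj₁ rows) j<
  go (suc i) (s≤s p) = code-≡⇒induced-≡ A vs ws len′ (proj₂ rows) p j<

PatternsDiffer⇒code-≢ : ∀ (A : ℕ → ℕ → Bool) vs ws → length vs ≡ length ws →
                        PatternsDiffer A vs ws → code A vs ≢ code A ws
PatternsDiffer⇒code-≢ A vs ws len (i , j , i<j , j< , differ) eq =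
  differ (code-≡⇒induced-≡ A vs ws len eq i<j j<)

-- Counting non-isomorphic induced subgraphs

∈-─ : ∀ {ys : List X} (p : x ∈ ys) → y ∈ ys → y ≢ x → y ∈ ys ─ p
∈-─ (here refl) (here refl) y≢x = ⊥-elim (y≢x refl)
∈-─ (here refl) (there q)   _   = q
∈-─ (there p)   (here refl) _   = here refl
∈-─ (there p)   (there q)   y≢x = there (∈-─ p q y≢x)

Unique⇒length≤ : ∀ {xs ys : List X} → Unique xs → All (_∈ ys) xs → length xs ≤ length ys
Unique⇒length≤ []                         []            = z≤n
Unique⇒length≤ {xs = x ∷ xs} {ys} (x≢xs ∷ uniq) (x∈ys ∷ xs⊆ys) = begin
  suc (length xs)          ≤⟨ s≤s (Unique⇒length≤ uniq (All.zipWith stays (xs⊆ys , x≢xs))) ⟩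
  suc (length (ys ─ x∈ys)) ≡⟨ List.length-removeAt′ ys (index x∈ys) ⟨
  length ys                ∎
  where
  open ≤-Reasoning
  stays : ∀ {z} → z ∈ ys × x ≢ z → z ∈ ys ─ x∈ys
  stays (z∈ys , x≢z) = ∈-─ x∈ys z∈ys (λ z≡x → x≢z (sym z≡x))

⊆⇒∈-choose : ∀ {xs ys : List ℕ} → xs ⊆ ys → xs ∈ choose (length xs) ys
⊆⇒∈-choose {[]}    _          = here refl
⊆⇒∈-choose {_ ∷ _} (_ ∷ʳ p)   = ∈-++⁺ʳ _ (⊆⇒∈-choose p)
⊆⇒∈-choose {_ ∷ _} (refl ∷ p) = ∈-++⁺ˡ (∈-map⁺ _ (⊆⇒∈-choose p))

data IncreasingFrom : ℕ → List ℕ → Set where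
  []  : ∀ {lo} → IncreasingFrom lo []
  _∷_ : ∀ {lo v vs} → lo ≤ v → IncreasingFrom (suc v) vs → IncreasingFrom lo (v ∷ vs)

IncreasingFrom-weaken : ∀ {lo′ lo vs} → lo′ ≤ lo → IncreasingFrom lo vs → IncreasingFrom lo′ vs
IncreasingFrom-weaken _      []          = []
IncreasingFrom-weaken lo′≤lo (lo≤v ∷ vs) = ≤-trans lo′≤lo lo≤v ∷ vs

IncreasingFrom⇒All≥ : ∀ {lo vs} → IncreasingFrom lo vs → All (lo ≤_) vs
IncreasingFrom⇒All≥ []          = []
IncreasingFrom⇒All≥ (lo≤v ∷ vs) =
  lo≤v ∷ All.map (≤-trans (m≤n⇒m≤1+n lo≤v)) (IncreasingFrom⇒All≥ vs)

IncreasingFrom-++ : ∀ {lo hi vs ws} → lo ≤ hi → IncreasingFrom lo vs → All (_< hi) vs →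
                    IncreasingFrom hi ws → IncreasingFrom lo (vs ++ ws)
IncreasingFrom-++ lo≤hi []          []           ws = IncreasingFrom-weaken lo≤hi ws
IncreasingFrom-++ _     (lo≤v ∷ vs) (v<hi ∷ vs<) ws = lo≤v ∷ IncreasingFrom-++ v<hi vs vs< ws

IncreasingFrom-map-+ : ∀ o {lo vs} → IncreasingFrom lo vs → IncreasingFrom (o + lo) (map (o +_) vs)
IncreasingFrom-map-+ o []                        = []
IncreasingFrom-map-+ o {vs = v ∷ vs} (lo≤v ∷ inc) =
  +-monoʳ-≤ o lo≤v ∷ subst (λ lo → IncreasingFrom lo (map (o +_) vs)) (+-suc o v) (IncreasingFrom-map-+ o inc)

-- f is only required to agree pointwise with (lo +_): the tail of applyUpTo (lo +_) is
-- applyUpTo (λ i → lo + suc i), which is not definitionally applyUpTo (suc lo +_).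
IncreasingFrom⇒⊆applyUpTo : ∀ {f lo} m → (∀ i → f i ≡ lo + i) → ∀ {vs} →
  IncreasingFrom lo vs → All (_< lo + m) vs → vs ⊆ applyUpTo f m
IncreasingFrom⇒⊆applyUpTo {f} m _ [] _ = minimum (applyUpTo f m)
IncreasingFrom⇒⊆applyUpTo {lo = lo} zero _ (lo≤v ∷ _) (v<lo+0 ∷ _) =
  ⊥-elim (<⇒≱ (subst (_ <_) (+-identityʳ lo) v<lo+0) lo≤v)
IncreasingFrom⇒⊆applyUpTo {f} {lo} (suc m) f≗ {v ∷ vs} (lo≤v ∷ inc) (v< ∷ vs<) =
  [ skip , keep ]′ (m≤n⇒m<n∨m≡n lo≤v)
  where
  recurse = IncreasingFrom⇒⊆applyUpTo m (λ i → trans (f≗ (suc i)) (+-suc lo i))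
  bound : ∀ {z} → z < lo + suc m → z < suc lo + m
  bound {z} = subst (z <_) (+-suc lo m)
  skip : lo < v → v ∷ vs ⊆ applyUpTo f (suc m)
  skip lo<v = f 0 ∷ʳ recurse (lo<v ∷ inc) (All.map bound (v< ∷ vs<))
  keep : lo ≡ v → v ∷ vs ⊆ applyUpTo f (suc m)
  keep lo≡v = sym (trans (f≗ 0) (trans (+-identityʳ lo) lo≡v))
            ∷ recurse (subst (λ w → IncreasingFrom (suc w) vs) (sym lo≡v) inc) (All.map bound vs<)

AllPairs-map-All : ∀ {P : X → Set} {R S : X → X → Set} {xs} →
  (∀ {x y} → P x → P y → R x y → S x y) → All P xs → AllPairs R xs → AllPairs S xs
AllPairs-map-All f []       []       = []
AllPairs-map-All f (p ∷ ps) (r ∷ rs) = All.zipWith (λ (q , r′) → f p q r′) (ps , r) ∷ AllPairs-map-All f ps rs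

SubsetList : ℕ → ℕ → ℕ → List ℕ → Set
SubsetList lo N n vs = IncreasingFrom lo vs × All (_< N) vs × length vs ≡ n

SubsetList⇒∈-choose : ∀ {N n vs} → SubsetList 0 N n vs → vs ∈ choose n (upTo N)
SubsetList⇒∈-choose {N} (inc , bounded , refl) =
  ⊆⇒∈-choose (IncreasingFrom⇒⊆applyUpTo N (λ _ → refl) inc bounded)

length≤S : ∀ G n (W : List (List ℕ)) → All (SubsetList 0 (order G) n) W →
           AllPairs (PatternsDiffer (adj G)) W → length W ≤ S n G
length≤S G n W valid distinct = begin
  length W                      ≡⟨ List.length-map (code (adj G)) W ⟨
  length (map (code (adj G)) W) ≤⟨ Unique⇒length≤ unique present ⟩
  S n G                         ∎
  where
  open ≤-Reasoning
  unique : Unique (map (code (adj G)) W)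
  unique = AllPairs.map⁺ (AllPairs-map-All
    (λ {vs} {ws} (_ , _ , lv) (_ , _ , lw) → PatternsDiffer⇒code-≢ (adj G) vs ws (trans lv (sym lw)))
    valid distinct)
  present : All (_∈ _) (map (code (adj G)) W)
  present = All.map⁺ (All.map
    (λ sub → ∈-deduplicate⁺ (List.≡-dec Bool._≟_) (∈-map⁺ (code (adj G)) (SubsetList⇒∈-choose sub)))
    valid)

-- Pieces and their concatenations across blocks

EveryCutCrossed : (ℕ → ℕ → Bool) → ℕ → Set
EveryCutCrossed B n = ∀ g → suc g < n → ∃₂ λ i j → i ≤ g × g < j × j < n × B i j ≡ true

Irreducible⇒EveryCutCrossed : ∀ H → Irreducible H → EveryCutCrossed (adj H) (order H)
Irreducible⇒EveryCutCrossed H irr g sg<n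
  with anyUpTo? (λ j → anyUpTo? (λ i → (i ≤? g) ×-dec (g <? j) ×-dec (adj H i j Bool.≟ true)) j) (order H)
... | yes (j , j<n , i , _ , i≤g , g<j , edge) = i , j , i≤g , g<j , j<n , edge
... | no none = ⊥-elim (irr g (suc g) (≤-refl , sg<n , separated))
  where
  separated : ∀ i j → Edge H i j → j ≤ g ⊎ suc g ≤ i
  separated i j (i<j , j<n , edge) with j ≤? g | suc g ≤? i
  ... | yes j≤g | _        = inj₁ j≤g
  ... | no  _   | yes g<i  = inj₂ g<i
  ... | no  j≰g | no  g≮i  = ⊥-elim (none (j , j<n , i , i<j , ≤-pred (≰⇒> g≮i) , ≰⇒> j≰g , edge))

record Piece (A : ℕ → ℕ → Bool) (lo hi : ℕ) (vs : List ℕ) : Set where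
  constructor piece
  field
    nonempty   : 1 ≤ length vs
    increasing : IncreasingFrom lo vs
    bounded    : All (_< hi) vs
    crossed    : EveryCutCrossed (induced A vs) (length vs)

Distinguishable : (ℕ → ℕ → Bool) → List ℕ → List ℕ → Set
Distinguishable A vs ws = length vs ≢ length ws ⊎ (length vs ≡ length ws × PatternsDiffer A vs ws)

-- A lower bound for the number of choices of n vertices that start with a piece of one of
-- the sizes ℓs, when the remaining n − ℓ vertices can be chosen in 2^(n − ℓ − 1) ways
-- (in one way if ℓ = n, matching the truncated subtraction).
growth : ℕ → List ℕ → ℕ
growth n []       = 0
growth n (ℓ ∷ ℓs) with ℓ ≤? n
... | yes _ = 2 ^ ((n ∸ ℓ) ∸ 1) + growth n ℓs
... | no  _ = growth n ℓs

record PieceFamily (A : ℕ → ℕ → Bool) (lo hi : ℕ) : Set where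
  field
    pieces          : List (List ℕ)
    valid           : All (Piece A lo hi) pieces
    distinguishable : AllPairs (Distinguishable A) pieces
    ample           : ∀ n → 2 ^ n ≤ growth (suc n) (map length pieces)

growth-1233 : ∀ n → 2 ^ n ≤ growth (suc n) (1 ∷ 2 ∷ 3 ∷ 3 ∷ [])
growth-1233 0 = s≤s z≤n
growth-1233 1 = s≤s (s≤s z≤n)
growth-1233 2 = s≤s (s≤s (s≤s (s≤s z≤n)))
growth-1233 (suc (suc (suc k))) = ≤-reflexive (doubling (2 ^ k))
  where
  doubling : ∀ x → 2 * (2 * (2 * x)) ≡ 2 * (2 * x) + (2 * x + (x + (x + 0)))
  doubling = solve-∀

growth-12344 : ∀ n → 2 ^ n ≤ growth (suc n) (1 ∷ 2 ∷ 3 ∷ 4 ∷ 4 ∷ [])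
growth-12344 0 = s≤s z≤n
growth-12344 1 = s≤s (s≤s z≤n)
growth-12344 2 = s≤s (s≤s (s≤s (s≤s z≤n)))
growth-12344 3 = s≤s (s≤s (s≤s (s≤s (s≤s (s≤s (s≤s (s≤s z≤n)))))))
growth-12344 (suc (suc (suc (suc k)))) = ≤-reflexive (doubling (2 ^ k))
  where
  doubling : ∀ x → 2 * (2 * (2 * (2 * x))) ≡ 2 * (2 * (2 * x)) + (2 * (2 * x) + (2 * x + (x + (x + 0))))
  doubling = solve-∀

extend : (ℕ → List (List ℕ)) → ℕ → List (List ℕ) → List (List ℕ)
extend sel n []       = []
extend sel n (P ∷ Ps) with length P ≤? n
... | yes _ = map (P ++_) (sel (n ∸ length P)) ++ extend sel n Ps
... | no  _ = extend sel n Ps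

extend-All : ∀ (Q : List ℕ → Set) sel n Ps →
  All (λ P → length P ≤ n → All (λ d → Q (P ++ d)) (sel (n ∸ length P))) Ps → All Q (extend sel n Ps)
extend-All Q sel n []       []       = []
extend-All Q sel n (P ∷ Ps) (h ∷ hs) with length P ≤? n
... | yes |P|≤n = All.++⁺ (All.map⁺ (h |P|≤n)) (extend-All Q sel n Ps hs)
... | no  _     = extend-All Q sel n Ps hs

growth≤length-extend : ∀ sel n Ps → All (λ P → 1 ≤ length P) Ps →
  (∀ k → k < n → 2 ^ (k ∸ 1) ≤ length (sel k)) → growth n (map length Ps) ≤ length (extend sel n Ps)
growth≤length-extend sel n []       []           _     = z≤n
growth≤length-extend sel n (P ∷ Ps) (1≤|P| ∷ ps) large with length P ≤? n
... | no  _     = growth≤length-extend sel n Ps ps large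
... | yes |P|≤n = begin
  2 ^ ((n ∸ length P) ∸ 1) + growth n (map length Ps)
    ≤⟨ +-mono-≤ (large (n ∸ length P) (∸-monoʳ-< 1≤|P| |P|≤n)) (growth≤length-extend sel n Ps ps large) ⟩
  length (sel (n ∸ length P)) + length (extend sel n Ps)
    ≡⟨ cong (_+ _) (List.length-map (P ++_) (sel (n ∸ length P))) ⟨
  length (map (P ++_) (sel (n ∸ length P))) + length (extend sel n Ps)
    ≡⟨ List.length-++ (map (P ++_) (sel (n ∸ length P))) ⟨
  length (map (P ++_) (sel (n ∸ length P)) ++ extend sel n Ps) ∎
  where open ≤-Reasoning

module Concatenation (A : ℕ → ℕ → Bool) where

  PatternsDiffer-sym : ∀ vs ws → length vs ≡ length ws → PatternsDiffer A vs ws → PatternsDiffer A ws vs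
  PatternsDiffer-sym vs ws len (i , j , i<j , j< , differ) = i , j , i<j , subst (j <_) len j< , λ eq → differ (sym eq)

  PatternsDiffer-++ˡ : ∀ P vs ws → PatternsDiffer A vs ws → PatternsDiffer A (P ++ vs) (P ++ ws)
  PatternsDiffer-++ˡ P vs ws (i , j , i<j , j< , differ) =
    length P + i , length P + j , +-monoʳ-< (length P) i<j ,
    subst (length P + j <_) (sym (List.length-++ P)) (+-monoʳ-< (length P) j<) ,
    λ eq → differ (begin
      induced A vs i j                       ≡⟨ cong₂ A (!-++ʳ P vs i) (!-++ʳ P vs j) ⟨
      induced A (P ++ vs) (length P + i) (length P + j) ≡⟨ eq ⟩
      induced A (P ++ ws) (length P + i) (length P + j) ≡⟨ cong₂ A (!-++ʳ P ws i) (!-++ʳ P ws j) ⟩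
      induced A ws i j                       ∎)
    where open ≡-Reasoning

  PatternsDiffer-++ʳ : ∀ P P′ vs ws → length P ≡ length P′ → PatternsDiffer A P P′ →
                       PatternsDiffer A (P ++ vs) (P′ ++ ws)
  PatternsDiffer-++ʳ P P′ vs ws len (i , j , i<j , j< , differ) =
    i , j , i<j , subst (j <_) (sym (List.length-++ P)) (≤-trans j< (m≤m+n (length P) (length vs))) ,
    λ eq → differ (begin
      induced A P i j          ≡⟨ cong₂ A (!-++ˡ P vs i<|P|) (!-++ˡ P vs j<) ⟨
      induced A (P ++ vs) i j  ≡⟨ eq ⟩
      induced A (P′ ++ ws) i j ≡⟨ cong₂ A (!-++ˡ P′ ws (subst (i <_) len i<|P|))
                                          (!-++ˡ P′ ws (subst (j <_) len j<)) ⟩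
      induced A P′ i j         ∎)
    where
    open ≡-Reasoning
    i<|P| = <-trans i<j j<

  NoEdgesBetween : List ℕ → List ℕ → Set
  NoEdgesBetween us vs = All (λ u → All (λ v → A u v ≡ false) vs) us

  PatternsDiffer-edgeLost : ∀ P vs P′ ws {i j} → NoEdgesBetween P vs →
    i < length P → length P ≤ j → j < length P′ → length P′ ≤ length P + length vs →
    induced A P′ i j ≡ true → PatternsDiffer A (P ++ vs) (P′ ++ ws)
  PatternsDiffer-edgeLost P vs P′ ws {i} {j} noEdges i<|P| |P|≤j j<|P′| |P′|≤ edge =
    i , j , <-≤-trans i<|P| |P|≤j , subst (j <_) (sym (List.length-++ P)) (<-≤-trans j<|P′| |P′|≤) ,
    λ eq → false≢true (trans (sym lost) (trans eq kept))
    where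
    open ≡-Reasoning
    t = j ∸ length P
    j≡ : length P + t ≡ j
    j≡ = m+[n∸m]≡n |P|≤j
    t<|vs| : t < length vs
    t<|vs| = +-cancelˡ-< (length P) t (length vs) (subst (_< _) (sym j≡) (<-≤-trans j<|P′| |P′|≤))
    lost : induced A (P ++ vs) i j ≡ false
    lost = begin
      A ((P ++ vs) ! i) ((P ++ vs) ! j)            ≡⟨ cong₂ A (!-++ˡ P vs i<|P|) (cong ((P ++ vs) !_) (sym j≡)) ⟩
      A (P ! i) ((P ++ vs) ! (length P + t))       ≡⟨ cong (A (P ! i)) (!-++ʳ P vs t) ⟩
      A (P ! i) (vs ! t)                           ≡⟨ All-! (All-! noEdges i<|P|) t<|vs| ⟩
      false                                        ∎
    kept : induced A (P′ ++ ws) i j ≡ true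
    kept = trans (cong₂ A (!-++ˡ P′ ws (<-trans (<-≤-trans i<|P|  |P|≤j) j<|P′|)) (!-++ˡ P′ ws j<|P′|)) edge

  -- The cut after the first |P| positions is crossed in P′, but not in P ++ vs.
  PatternsDiffer-shorter : ∀ P vs P′ ws → NoEdgesBetween P vs → 1 ≤ length P →
    length P < length P′ → length P′ ≤ length P + length vs →
    EveryCutCrossed (induced A P′) (length P′) → PatternsDiffer A (P ++ vs) (P′ ++ ws)
  PatternsDiffer-shorter P vs P′ ws noEdges 1≤|P| |P|<|P′| |P′|≤ cuts
    with i , j , i≤g , g<j , j<|P′| , edge ←
           cuts (length P ∸ 1) (subst (_< length P′) (sym (m+[n∸m]≡n 1≤|P|)) |P|<|P′|) =
    PatternsDiffer-edgeLost P vs P′ ws noEdges (subst (i <_) (m+[n∸m]≡n 1≤|P|) (s≤s i≤g))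
      (subst (_≤ j) (m+[n∸m]≡n 1≤|P|) g<j) j<|P′| |P′|≤ edge

NoEdgeOut : OGraph → ℕ → ℕ → Set
NoEdgeOut G o b = ∀ i j → o ≤ i → i < o + b → o + b ≤ j → ¬ Edge G i j

module Block (G : OGraph) (o b : ℕ) (noEdge : NoEdgeOut G o b) where

  open Concatenation (adj G)

  Tail : ℕ → List ℕ → Set
  Tail = SubsetList (o + b) (order G)

  noEdgesBetween : ∀ {P k d} → Piece (adj G) o (o + b) P → Tail k d → NoEdgesBetween P d
  noEdgesBetween (piece _ incP P<o+b _) (incd , d<N , _) =
    All.zipWith (λ (o≤x , x<o+b) → All.zipWith (λ (o+b≤y , y<N) →
        Bool.¬-not (λ e → noEdge _ _ o≤x x<o+b o+b≤y (<-≤-trans x<o+b o+b≤y , y<N , e)))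
      (IncreasingFrom⇒All≥ incd , d<N))
    (IncreasingFrom⇒All≥ incP , P<o+b)

  concat-differ : ∀ {P P′ k k′ d d′} → Piece (adj G) o (o + b) P → Piece (adj G) o (o + b) P′ →
    Distinguishable (adj G) P P′ → Tail k d → Tail k′ d′ → length P + k ≡ length P′ + k′ →
    PatternsDiffer (adj G) (P ++ d) (P′ ++ d′)
  concat-differ {P} {P′} {d = d} {d′} _ _ (inj₂ (len , differ)) _ _ _ = PatternsDiffer-++ʳ P P′ d d′ len differ
  concat-differ {P} {P′} {k} {k′} {d} {d′} pP pP′ (inj₁ len≢) td@(_ , _ , refl) td′@(_ , _ , refl) total
    with <-cmp (length P) (length P′)
  ... | tri< lt _ _ = PatternsDiffer-shorter P d P′ d′ (noEdgesBetween pP td) (Piece.nonempty pP) lt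
                        (≤-trans (m≤m+n (length P′) k′) (≤-reflexive (sym total))) (Piece.crossed pP′)
  ... | tri≈ _ eq _ = ⊥-elim (len≢ eq)
  ... | tri> _ _ gt = PatternsDiffer-sym (P′ ++ d′) (P ++ d) lengths
                        (PatternsDiffer-shorter P′ d′ P d (noEdgesBetween pP′ td′) (Piece.nonempty pP′) gt
                          (≤-trans (m≤m+n (length P) k) (≤-reflexive total)) (Piece.crossed pP))
    where
    lengths : length (P′ ++ d′) ≡ length (P ++ d)
    lengths = trans (List.length-++ P′) (trans (sym total) (sym (List.length-++ P)))

  extend-distinct : ∀ sel n Ps → All (Piece (adj G) o (o + b)) Ps → AllPairs (Distinguishable (adj G)) Ps →
    (∀ k → All (Tail k) (sel k)) → (∀ k → AllPairs (PatternsDiffer (adj G)) (sel k)) →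
    AllPairs (PatternsDiffer (adj G)) (extend sel n Ps)
  extend-distinct sel n []       _          _          _     _        = []
  extend-distinct sel n (P ∷ Ps) (pP ∷ pPs) (dP ∷ dPs) tails distinct with length P ≤? n
  ... | no  _     = extend-distinct sel n Ps pPs dPs tails distinct
  ... | yes |P|≤n = AllPairs.++⁺
    (AllPairs.map⁺ (AllPairs.map (λ {vs} {ws} → PatternsDiffer-++ˡ P vs ws) (distinct (n ∸ length P))))
    (extend-distinct sel n Ps pPs dPs tails distinct)
    (All.map⁺ (All.map acrossPieces (tails (n ∸ length P))))
    where
    acrossPieces : ∀ {d} → Tail (n ∸ length P) d → All (PatternsDiffer (adj G) (P ++ d)) (extend sel n Ps)
    acrossPieces td = extend-All _ sel n Ps (All.zipWith
      (λ (pP′ , dPP′) |P′|≤n → All.map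
         (λ td′ → concat-differ pP pP′ dPP′ td td′ (trans (m+[n∸m]≡n |P|≤n) (sym (m+[n∸m]≡n |P′|≤n))))
         (tails _))
      (pPs , dP))

module Chains (G : OGraph) where

  data Chain : ℕ → Set where
    []    : ∀ {lo} → Chain lo
    block : ∀ {lo} o b → lo ≤ o → o + b ≤ order G → NoEdgeOut G o b →
            PieceFamily (adj G) o (o + b) → Chain (o + b) → Chain lo

  blockCount : ∀ {lo} → Chain lo → ℕ
  blockCount []                     = 0
  blockCount (block _ _ _ _ _ _ ch) = suc (blockCount ch)

  selections : ∀ {lo} → ℕ → Chain lo → List (List ℕ)
  selections zero    _                      = [] ∷ []
  selections (suc n) []                     = []
  selections (suc n) (block _ _ _ _ _ F ch) =
    extend (λ k → selections k ch) (suc n) (PieceFamily.pieces F)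

  selections-valid : ∀ {lo} n (ch : Chain lo) → All (SubsetList lo (order G) n) (selections n ch)
  selections-valid zero    _  = ([] , [] , refl) ∷ []
  selections-valid (suc n) [] = []
  selections-valid {lo} (suc n) (block o b lo≤o o+b≤N _ F ch) =
    extend-All _ _ (suc n) (PieceFamily.pieces F) (All.map prepend (PieceFamily.valid F))
    where
    prepend : ∀ {P} → Piece (adj G) o (o + b) P → length P ≤ suc n →
              All (λ d → SubsetList lo (order G) (suc n) (P ++ d)) (selections (suc n ∸ length P) ch)
    prepend {P} (piece _ incP P<o+b _) |P|≤ = All.map
      (λ (incd , d<N , |d|≡) →
           IncreasingFrom-++ (≤-trans lo≤o (m≤m+n o b)) (IncreasingFrom-weaken lo≤o incP) P<o+b incd ,
           All.++⁺ (All.map (λ x< → <-≤-trans x< o+b≤N) P<o+b) d<N ,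
           trans (List.length-++ P) (trans (cong (length P +_) |d|≡) (m+[n∸m]≡n |P|≤)))
      (selections-valid (suc n ∸ length P) ch)

  selections-distinct : ∀ {lo} n (ch : Chain lo) → AllPairs (PatternsDiffer (adj G)) (selections n ch)
  selections-distinct zero    _  = [] ∷ []
  selections-distinct (suc n) [] = []
  selections-distinct (suc n) (block o b _ _ noEdge F ch) =
    Block.extend-distinct G o b noEdge _ (suc n) (PieceFamily.pieces F)
      (PieceFamily.valid F) (PieceFamily.distinguishable F)
      (λ k → selections-valid k ch) (λ k → selections-distinct k ch)

  selections-length : ∀ {lo} n (ch : Chain lo) → n ≤ blockCount ch → 2 ^ (n ∸ 1) ≤ length (selections n ch)
  selections-length zero    _ _ = ≤-refl
  selections-length (suc n) (block _ _ _ _ _ F ch) (s≤s n≤count) =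
    ≤-trans (PieceFamily.ample F n)
      (growth≤length-extend _ (suc n) (PieceFamily.pieces F) (All.map Piece.nonempty (PieceFamily.valid F))
        (λ k k≤n → selections-length k ch (≤-trans (≤-pred k≤n) n≤count)))

-- Irreducible ordered graphs outside 𝒥

0<1 : 0 < 1
0<1 = s≤s z≤n

0<2 : 0 < 2
0<2 = s≤s z≤n

1<2 : 1 < 2
1<2 = s≤s (s≤s z≤n)

1<3 : 1 < 3
1<3 = s≤s (s≤s z≤n)

2<3 : 2 < 3
2<3 = s≤s (s≤s (s≤s z≤n))

2<4 : 2 < 4
2<4 = s≤s (s≤s (s≤s z≤n))

between-1-3 : ∀ {i j} → 1 ≤ i → i < j → j < 3 → i ≡ 1 × j ≡ 2
between-1-3 1≤i i<j j<3 with refl ← ≤-antisym (≤-pred j<3) (≤-trans (s≤s 1≤i) i<j) =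
  ≤-antisym (≤-pred i<j) 1≤i , refl

between-1-4 : ∀ {i j k} → 1 ≤ i → i < j → j < k → k < 4 → i ≡ 1 × j ≡ 2 × k ≡ 3
between-1-4 1≤i i<j j<k k<4
  with refl ← ≤-antisym (≤-pred k<4) (≤-trans (s≤s (≤-trans (s≤s 1≤i) i<j)) j<k) =
  proj₁ (between-1-3 1≤i i<j j<k) , proj₂ (between-1-3 1≤i i<j j<k) , refl

module Classification (h : ℕ) (B : ℕ → ℕ → Bool) (cuts : EveryCutCrossed B h) where

  Agrees : (ℕ → ℕ → Bool) → Set
  Agrees J = ∀ i j → i < j → j < h → B i j ≡ J i j

  Profile : Set
  Profile = Bool × Bool × Bool

  profile : ℕ → ℕ → ℕ → Profile
  profile a b c = B a b , B a c , B b c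

  profile-ab : ∀ {a b c x y z} → profile a b c ≡ (x , y , z) → B a b ≡ x
  profile-ab refl = refl

  profile-ac : ∀ {a b c x y z} → profile a b c ≡ (x , y , z) → B a c ≡ y
  profile-ac refl = refl

  profile-bc : ∀ {a b c x y z} → profile a b c ≡ (x , y , z) → B b c ≡ z
  profile-bc refl = refl

  IrreducibleTriple : ℕ → ℕ → ℕ → Set
  IrreducibleTriple a b c = B a c ≡ true ⊎ (B a b ≡ true × B b c ≡ true)

  _≟ᵖ_ : DecidableEquality Profile
  _≟ᵖ_ = ≡-dec Bool._≟_ (≡-dec Bool._≟_ Bool._≟_)

  irreducible? : ∀ a b c → Dec (IrreducibleTriple a b c)
  irreducible? a b c = (B a c Bool.≟ true) ⊎-dec ((B a b Bool.≟ true) ×-dec (B b c Bool.≟ true))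

  Uniform : Profile → Set
  Uniform T = ∀ a b c → a < b → b < c → c < h → IrreducibleTriple a b c → profile a b c ≡ T

  uniform-complete : Uniform (true , true , true) → Agrees (λ _ _ → true)
  uniform-complete uniform = complete
    where
    inside : ∀ {p q x y} → B p q ≡ true → p ≤ x → x < y → y ≤ q → q < h → B x y ≡ true
    inside {p} {q} {x} {y} pq p≤x x<y y≤q q<h = [ (λ y<q → profile-ab (uniform x y q x<y y<q q<h (inj₁ xq))) ,
                                                  (λ { refl → xq }) ]′ (m≤n⇒m<n∨m≡n y≤q)
      where
      xq : B x q ≡ true
      xq = [ (λ p<x → profile-bc (uniform p x q p<x (<-≤-trans x<y y≤q) q<h (inj₁ pq))) ,
             (λ { refl → pq }) ]′ (m≤n⇒m<n∨m≡n p≤x)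
    consecutive : ∀ i → suc i < h → B i (suc i) ≡ true
    consecutive i si<h with p , q , p≤i , i<q , q<h , pq ← cuts i si<h = inside pq p≤i ≤-refl i<q q<h
    complete : ∀ i j → i < j → j < h → B i j ≡ true
    complete i (suc j) (s≤s i≤j) sj<h with m≤n⇒m<n∨m≡n i≤j
    ... | inj₂ refl = consecutive i sj<h
    ... | inj₁ i<j  = profile-ac (uniform i j (suc j) i<j ≤-refl sj<h
                        (inj₂ (complete i j i<j (<-trans (n<1+n j) sj<h) , consecutive j sj<h)))

  uniform-path : Uniform (true , false , true) → Agrees (adj (L h))
  uniform-path uniform = agrees
    where
    long-absent : ∀ {p q} → suc p < q → q < h → B p q ≡ false
    long-absent {p} {q} sp<q q<h =
      false-if-refuted λ pq → profile-ac (uniform p (suc p) q ≤-refl sp<q q<h (inj₁ pq))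
    consecutive : ∀ i → suc i < h → B i (suc i) ≡ true
    consecutive i si<h with p , q , p≤i , i<q , q<h , pq ← cuts i si<h
      with <-cmp (suc p) q
    ... | tri< sp<q _ _ = ⊥-elim (false≢true (trans (sym (long-absent sp<q q<h)) pq))
    ... | tri> _ _ q≤p  = ⊥-elim (<⇒≱ i<q (≤-trans (≤-pred q≤p) p≤i))
    ... | tri≈ _ refl _ with refl ← ≤-antisym p≤i (≤-pred i<q) = pq
    agrees : Agrees (adj (L h))
    agrees i j i<j j<h with m≤n⇒m<n∨m≡n i<j
    ... | inj₂ refl = trans (consecutive i j<h) (sym (dec-true (suc i ≟ suc i) refl))
    ... | inj₁ si<j = trans (long-absent si<j j<h) (sym (dec-false (j ≟ suc i) (>⇒≢ si<j)))

  uniform-starFromFirst : Uniform (true , true , false) → Agrees (adj (J₃ h))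
  uniform-starFromFirst uniform = agrees
    where
    later-absent : ∀ i j → 1 ≤ i → i < j → j < h → B i j ≡ false
    later-absent (suc i) j _ i<j j<h = false-if-refuted refuted
      where
      refuted : B (suc i) j ≡ true → B (suc i) j ≡ false
      refuted ij with p , q , p≤i , i<q , q<h , pq ← cuts i (<-trans i<j j<h)
        with m≤n⇒m<n∨m≡n i<q
      ... | inj₂ refl = profile-bc (uniform p (suc i) j (s≤s p≤i) i<j j<h (inj₂ (pq , ij)))
      ... | inj₁ si<q = profile-bc (uniform p (suc i) j (s≤s p≤i) i<j j<h
                          (inj₂ (profile-ab (uniform p (suc i) q (s≤s p≤i) si<q q<h (inj₁ pq)) , ij)))
    first-present : ∀ j → 0 < j → j < h → B 0 j ≡ true
    first-present (suc j) _ sj<h with cuts j sj<h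
    ... | suc p , q , sp≤j , j<q , q<h , pq =
      ⊥-elim (false≢true (trans (sym (later-absent (suc p) q (s≤s z≤n) (≤-<-trans sp≤j j<q) q<h)) pq))
    ... | zero  , q , _ , j<q , q<h , pq with m≤n⇒m<n∨m≡n j<q
    ...   | inj₂ refl = pq
    ...   | inj₁ sj<q = profile-ab (uniform 0 (suc j) q (s≤s z≤n) sj<q q<h (inj₁ pq))
    agrees : Agrees (adj (J₃ h))
    agrees zero    j 0<j j<h = first-present j 0<j j<h
    agrees (suc i) j i<j j<h = later-absent (suc i) j (s≤s z≤n) i<j j<h

  uniform-starToLast : Uniform (false , true , true) → Agrees (adj (J₄ h))
  uniform-starToLast uniform = agrees
    where
    inner-absent : ∀ i j → i < j → suc j < h → B i j ≡ false
    inner-absent i j i<j sj<h = false-if-refuted refuted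
      where
      refuted : B i j ≡ true → B i j ≡ false
      refuted ij with p , q , p≤j , j<q , q<h , pq ← cuts j sj<h
        with m≤n⇒m<n∨m≡n p≤j
      ... | inj₂ refl = profile-ab (uniform i j q i<j j<q q<h (inj₂ (ij , pq)))
      ... | inj₁ p<j  = profile-ab (uniform i j q i<j j<q q<h
                          (inj₂ (ij , profile-bc (uniform p j q p<j j<q q<h (inj₁ pq)))))
    last-present : ∀ i j → i < j → suc j ≡ h → B i j ≡ true
    last-present i j i<j sj≡h
      with p , q , p≤i , i<q , q<h , pq ← cuts i (<-≤-trans (s≤s i<j) (≤-reflexive sj≡h))
      with <-cmp q j
    ... | tri< q<j _ _ = ⊥-elim (false≢true (trans (sym (inner-absent p q (≤-<-trans p≤i i<q)
                                                 (<-≤-trans (s≤s q<j) (≤-reflexive sj≡h)))) pq))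
    ... | tri> _ _ j<q = ⊥-elim (<⇒≱ q<h (≤-trans (≤-reflexive (sym sj≡h)) j<q))
    ... | tri≈ _ refl _ with m≤n⇒m<n∨m≡n p≤i
    ...   | inj₂ refl = pq
    ...   | inj₁ p<i  = profile-bc (uniform p i q p<i i<j q<h (inj₁ pq))
    agrees : Agrees (adj (J₄ h))
    agrees i j i<j j<h with <-cmp (suc j) h
    ... | tri< sj<h _ _ = trans (inner-absent i j i<j sj<h) (sym (dec-false (suc j ≟ h) (<⇒≢ sj<h)))
    ... | tri≈ _ sj≡h _ = trans (last-present i j i<j sj≡h) (sym (dec-true (suc j ≟ h) sj≡h))
    ... | tri> _ _ h<sj = ⊥-elim (<⇒≱ h<sj j<h)

  ∈𝒥-J₁ : Agrees (adj (J₁ h)) → mkOGraph h B ∈𝒥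
  ∈𝒥-J₁ agrees = h , inj₁ (refl , agrees)

  ∈𝒥-J₂ : Agrees (adj (J₂ h)) → mkOGraph h B ∈𝒥
  ∈𝒥-J₂ agrees = h , inj₂ (inj₁ (refl , agrees))

  ∈𝒥-J₃ : Agrees (adj (J₃ h)) → mkOGraph h B ∈𝒥
  ∈𝒥-J₃ agrees = h , inj₂ (inj₂ (inj₁ (refl , agrees)))

  ∈𝒥-J₄ : Agrees (adj (J₄ h)) → mkOGraph h B ∈𝒥
  ∈𝒥-J₄ agrees = h , inj₂ (inj₂ (inj₂ (inj₁ (refl , agrees))))

  ∈𝒥-L : Agrees (adj (L h)) → mkOGraph h B ∈𝒥
  ∈𝒥-L agrees = h , inj₂ (inj₂ (inj₂ (inj₂ (inj₁ (refl , agrees)))))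

  ∈𝒥-Q₁ : h ≡ 4 → Agrees (adj Q₁) → mkOGraph h B ∈𝒥
  ∈𝒥-Q₁ h≡4 agrees = h , inj₂ (inj₂ (inj₂ (inj₂ (inj₂ (inj₁ (h≡4 , agrees))))))

  ∈𝒥-Q₂ : h ≡ 4 → Agrees (adj Q₂) → mkOGraph h B ∈𝒥
  ∈𝒥-Q₂ h≡4 agrees = h , inj₂ (inj₂ (inj₂ (inj₂ (inj₂ (inj₂ (h≡4 , agrees))))))

  agrees-on-4 : ∀ (J : ℕ → ℕ → Bool) → h ≡ 4 →
    B 0 1 ≡ J 0 1 → B 0 2 ≡ J 0 2 → B 0 3 ≡ J 0 3 → B 1 2 ≡ J 1 2 → B 1 3 ≡ J 1 3 → B 2 3 ≡ J 2 3 →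
    Agrees J
  agrees-on-4 J refl e01 e02 e03 e12 e13 e23 = λ where
    0 1 _ _ → e01
    0 2 _ _ → e02
    0 3 _ _ → e03
    1 2 _ _ → e12
    1 3 _ _ → e13
    2 3 _ _ → e23
    _ (suc (suc (suc (suc _)))) _ (s≤s (s≤s (s≤s (s≤s ()))))
    _ 0 () _
    (suc _) 1 (s≤s ()) _
    (suc (suc _)) 2 (s≤s (s≤s ())) _
    (suc (suc (suc _))) 3 (s≤s (s≤s (s≤s ()))) _

  record Triple : Set where
    constructor triple
    field
      a b c       : ℕ
      a<b         : a < b
      b<c         : b < c
      c<h         : c < h
      irreducible : IrreducibleTriple a b c

    vertices : List ℕ
    vertices = a ∷ b ∷ c ∷ []

  record Quadruple : Set where
    constructor quadruple
    field
      a b c d     : ℕ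
      a<b         : a < b
      b<c         : b < c
      c<d         : c < d
      d<h         : d < h
      irreducible : B a d ≡ true ⊎ (B a c ≡ true × B b d ≡ true)

    vertices : List ℕ
    vertices = a ∷ b ∷ c ∷ d ∷ []

  triple-piece : (t : Triple) → Piece B 0 h (Triple.vertices t)
  triple-piece (triple a b c a<b b<c c<h irr) =
    piece (s≤s z≤n) (z≤n ∷ a<b ∷ b<c ∷ [])
      (<-trans a<b (<-trans b<c c<h) ∷ <-trans b<c c<h ∷ c<h ∷ []) (crossed irr)
    where
    crossed : IrreducibleTriple a b c → EveryCutCrossed (induced B (a ∷ b ∷ c ∷ [])) 3
    crossed (inj₁ ac)       0 _ = 0 , 2 , z≤n , s≤s z≤n , ≤-refl , ac
    crossed (inj₂ (ab , _)) 0 _ = 0 , 1 , z≤n , s≤s z≤n , s≤s (s≤s z≤n) , ab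
    crossed (inj₁ ac)       1 _ = 0 , 2 , z≤n , ≤-refl , ≤-refl , ac
    crossed (inj₂ (_ , bc)) 1 _ = 1 , 2 , ≤-refl , ≤-refl , ≤-refl , bc
    crossed _               (suc (suc _)) (s≤s (s≤s (s≤s ())))

  quadruple-piece : (q : Quadruple) → Piece B 0 h (Quadruple.vertices q)
  quadruple-piece (quadruple a b c d a<b b<c c<d d<h irr) =
    piece (s≤s z≤n) (z≤n ∷ a<b ∷ b<c ∷ c<d ∷ [])
      (<-trans a<b (<-trans b<c (<-trans c<d d<h)) ∷ <-trans b<c (<-trans c<d d<h) ∷ <-trans c<d d<h ∷ d<h ∷ [])
      (crossed irr)
    where
    crossed : B a d ≡ true ⊎ (B a c ≡ true × B b d ≡ true) →
              EveryCutCrossed (induced B (a ∷ b ∷ c ∷ d ∷ [])) 4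
    crossed (inj₁ ad)       0 _ = 0 , 3 , z≤n , s≤s z≤n , ≤-refl , ad
    crossed (inj₁ ad)       1 _ = 0 , 3 , z≤n , s≤s (s≤s z≤n) , ≤-refl , ad
    crossed (inj₁ ad)       2 _ = 0 , 3 , z≤n , ≤-refl , ≤-refl , ad
    crossed (inj₂ (ac , _)) 0 _ = 0 , 2 , z≤n , s≤s z≤n , s≤s (s≤s (s≤s z≤n)) , ac
    crossed (inj₂ (ac , _)) 1 _ = 0 , 2 , z≤n , ≤-refl , s≤s (s≤s (s≤s z≤n)) , ac
    crossed (inj₂ (_ , bd)) 2 _ = 1 , 3 , s≤s z≤n , ≤-refl , ≤-refl , bd
    crossed _               (suc (suc (suc _))) (s≤s (s≤s (s≤s (s≤s ()))))

  data Witness : Set where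
    distinctTriples    : (t u : Triple) →
                         PatternsDiffer B (Triple.vertices t) (Triple.vertices u) → Witness
    distinctQuadruples : Triple → (q r : Quadruple) →
                         PatternsDiffer B (Quadruple.vertices q) (Quadruple.vertices r) → Witness

  witness⇒PieceFamily : ∀ {j} → 0 < j → j < h → B 0 j ≡ true → Witness → PieceFamily B 0 h
  witness⇒PieceFamily {j} 0<j j<h edge0j w = family w
    where
    vertex : Piece B 0 h (0 ∷ [])
    vertex = piece (s≤s z≤n) (z≤n ∷ []) (<-trans 0<j j<h ∷ []) λ { _ (s≤s ()) }
    edge : Piece B 0 h (0 ∷ j ∷ [])
    edge = piece (s≤s z≤n) (z≤n ∷ 0<j ∷ []) (<-trans 0<j j<h ∷ j<h ∷ [])
             λ { 0 _ → 0 , 1 , z≤n , s≤s z≤n , ≤-refl , edge0j ; (suc _) (s≤s (s≤s ())) }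
    family : Witness → PieceFamily B 0 h
    family (distinctTriples t u differ) = record
      { pieces          = (0 ∷ []) ∷ (0 ∷ j ∷ []) ∷ Triple.vertices t ∷ Triple.vertices u ∷ []
      ; valid           = vertex ∷ edge ∷ triple-piece t ∷ triple-piece u ∷ []
      ; distinguishable = (inj₁ (λ ()) ∷ inj₁ (λ ()) ∷ inj₁ (λ ()) ∷ [])
                        ∷ (inj₁ (λ ()) ∷ inj₁ (λ ()) ∷ [])
                        ∷ (inj₂ (refl , differ) ∷ [])
                        ∷ [] ∷ []
      ; ample           = growth-1233 }
    family (distinctQuadruples t q r differ) = record
      { pieces          = (0 ∷ []) ∷ (0 ∷ j ∷ []) ∷ Triple.vertices t
                        ∷ Quadruple.vertices q ∷ Quadruple.vertices r ∷ []
      ; valid           = vertex ∷ edge ∷ triple-piece t ∷ quadruple-piece q ∷ quadruple-piece r ∷ []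
      ; distinguishable = (inj₁ (λ ()) ∷ inj₁ (λ ()) ∷ inj₁ (λ ()) ∷ inj₁ (λ ()) ∷ [])
                        ∷ (inj₁ (λ ()) ∷ inj₁ (λ ()) ∷ inj₁ (λ ()) ∷ [])
                        ∷ (inj₁ (λ ()) ∷ inj₁ (λ ()) ∷ [])
                        ∷ (inj₂ (refl , differ) ∷ [])
                        ∷ [] ∷ []
      ; ample           = growth-12344 }

  module UniformJ₂ (uniform : Uniform (false , true , false)) (t₀ : Triple) where

    gaps-absent : ∀ {a b c} → B a c ≡ true → a < b → b < c → c < h → B a b ≡ false × B b c ≡ false
    gaps-absent {a} {b} {c} ac a<b b<c c<h = profile-ab u , profile-bc u
      where u = uniform a b c a<b b<c c<h (inj₁ ac)

    no-twoPath : ∀ {a b c} → a < b → b < c → c < h → B a b ≡ true → B b c ≡ true → ⊥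
    no-twoPath {a} {b} {c} a<b b<c c<h ab bc =
      false≢true (trans (sym (profile-ab (uniform a b c a<b b<c c<h (inj₂ (ab , bc))))) ab)

    last : ℕ
    last = h ∸ 1

    3≤h : 3 ≤ h
    3≤h = let open Triple t₀ in ≤-trans (s≤s (≤-trans (s≤s (≤-trans (s≤s z≤n) a<b)) b<c)) c<h

    suc-last : suc last ≡ h
    suc-last = m+[n∸m]≡n (≤-trans (s≤s z≤n) 3≤h)

    last<h : last < h
    last<h = ≤-reflexive suc-last

    j≤last : ∀ {j} → j < h → j ≤ last
    j≤last j<h = ≤-pred (≤-trans j<h (≤-reflexive (sym suc-last)))

    j<last⇒sj<h : ∀ {j} → j < last → suc j < h
    j<last⇒sj<h j<last = ≤-trans (s≤s j<last) (≤-reflexive suc-last)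

    last≡3⇒h≡4 : 3 ≡ last → h ≡ 4
    last≡3⇒h≡4 3≡last = trans (sym suc-last) (cong suc (sym 3≡last))

    module LastEdgePresent (edge0last : B 0 last ≡ true) where

      inner-absent⇒J₂ : (∀ i j → 1 ≤ i → i < j → j < last → B i j ≡ false) → Agrees (adj (J₂ h))
      inner-absent⇒J₂ inner zero j 0<j j<h with m≤n⇒m<n∨m≡n (j≤last j<h)
      ... | inj₁ j<last = trans (proj₁ (gaps-absent edge0last 0<j j<last last<h))
                                (sym (dec-false (suc j ≟ h) (<⇒≢ (j<last⇒sj<h j<last))))
      ... | inj₂ refl   = trans edge0last (sym (dec-true (suc last ≟ h) suc-last))
      inner-absent⇒J₂ inner (suc i) j i<j j<h with m≤n⇒m<n∨m≡n (j≤last j<h)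
      ... | inj₁ j<last = inner (suc i) j (s≤s z≤n) i<j j<last
      ... | inj₂ refl   = proj₂ (gaps-absent edge0last (s≤s z≤n) i<j last<h)

      inner-edge⇒result : ∀ i j → 1 ≤ i → i < j → j < last → B i j ≡ true →
                          Witness ⊎ mkOGraph h B ∈𝒥
      inner-edge⇒result i j 1≤i i<j j<last ij with <-cmp 3 last
      ... | tri> _ _ last<3 = ⊥-elim (<⇒≱ (≤-trans j<last (≤-pred last<3)) (≤-trans (s≤s 1≤i) i<j))
      ... | tri≈ _ 3≡last _ with refl , refl ← between-1-3 1≤i i<j (subst (j <_) (sym 3≡last) j<last) =
        inj₂ (∈𝒥-Q₂ h≡4 (agrees-on-4 (adj Q₂) h≡4 (proj₁ (gaps-absent edge03 0<1 1<3 3<h))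
          (proj₁ (gaps-absent edge03 0<2 2<3 3<h)) edge03 ij (proj₂ (gaps-absent edge03 0<1 1<3 3<h))
          (proj₂ (gaps-absent edge03 0<2 2<3 3<h))))
        where
        h≡4 = last≡3⇒h≡4 3≡last
        edge03 = subst (λ l → B 0 l ≡ true) (sym 3≡last) edge0last
        3<h = subst (3 <_) (sym h≡4) ≤-refl
      ... | tri< 3<last _ _ with B 1 2 in b₁₂
      ...   | false = inj₁ (distinctQuadruples t₀ q
                        (quadruple 0 1 2 last 0<1 1<2 (<-trans 2<3 3<last) last<h (inj₁ edge0last))
                        (1 , 2 , 1<2 , 2<4 , λ eq → false≢true (trans (sym b₁₂) (trans (sym eq) ij))))
        where q = quadruple 0 i j last 1≤i i<j j<last last<h (inj₁ edge0last)
      ...   | true  = inj₁ (distinctQuadruples t₀ q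
                        (quadruple 0 2 3 last 0<2 2<3 3<last last<h (inj₁ edge0last))
                        (1 , 2 , 1<2 , 2<4 , λ eq → false≢true (trans (sym b₂₃) (trans (sym eq) ij))))
        where
        q = quadruple 0 i j last 1≤i i<j j<last last<h (inj₁ edge0last)
        b₂₃ : B 2 3 ≡ false
        b₂₃ = Bool.¬-not (no-twoPath 1<2 2<3 (<-trans 3<last last<h) b₁₂)

      result : Witness ⊎ mkOGraph h B ∈𝒥
      result with anyUpTo? (λ j → anyUpTo? (λ i → (1 ≤? i) ×-dec (B i j Bool.≟ true)) j) last
      ... | yes (j , j<last , i , i<j , 1≤i , ij) = inner-edge⇒result i j 1≤i i<j j<last ij
      ... | no none = inj₂ (∈𝒥-J₂ (inner-absent⇒J₂ λ i j 1≤i i<j j<last →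
                        Bool.¬-not λ ij → none (j , j<last , i , i<j , 1≤i , ij)))

    module LastEdgeAbsent (no-edge0last : B 0 last ≡ false) where

      record Crossing : Set where
        constructor crossing
        field
          {i j k}  : ℕ
          1≤i      : 1 ≤ i
          i<j      : i < j
          j<k      : j < k
          k<h      : k < h
          edge0j   : B 0 j ≡ true
          edgeik   : B i k ≡ true

      find-crossing : Crossing
      find-crossing with cuts 0 (≤-trans (s≤s (s≤s z≤n)) 3≤h)
      ... | suc _ , _ , () , _
      ... | zero , j , _ , 0<j , j<h , edge0j with m≤n⇒m<n∨m≡n (j≤last j<h)
      ...   | inj₂ refl   = ⊥-elim (false≢true (trans (sym no-edge0last) edge0j))
      ...   | inj₁ j<last with cuts j (j<last⇒sj<h j<last)
      ...     | zero , k , _ , j<k , k<h , edge0k =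
                ⊥-elim (false≢true (trans (sym (proj₁ (gaps-absent edge0k 0<j j<k k<h))) edge0j))
      ...     | suc i , k , si≤j , j<k , k<h , edgeik with m≤n⇒m<n∨m≡n si≤j
      ...       | inj₂ refl = ⊥-elim (no-twoPath 0<j j<k k<h edge0j edgeik)
      ...       | inj₁ si<j = crossing (s≤s z≤n) si<j j<k k<h edge0j edgeik

      no-edge0k : (c : Crossing) → B 0 (Crossing.k c) ≡ false
      no-edge0k (crossing 1≤i i<j j<k k<h edge0j _) = Bool.¬-not λ edge0k →
        false≢true (trans (sym (proj₁ (gaps-absent edge0k (<-trans 1≤i i<j) j<k k<h))) edge0j)

      last≡3⇒Q₁ : Crossing → 3 ≡ last → Agrees (adj Q₁)
      last≡3⇒Q₁ (crossing {k = k} 1≤i i<j j<k k<h edge0j edgeik) 3≡last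
        with refl , refl , refl ← between-1-4 1≤i i<j j<k (subst (k <_) (last≡3⇒h≡4 3≡last) k<h) =
        agrees-on-4 (adj Q₁) h≡4 (proj₁ (gaps-absent edge0j 0<1 1<2 2<h)) edge0j
          (subst (λ l → B 0 l ≡ false) (sym 3≡last) no-edge0last) (proj₂ (gaps-absent edge0j 0<1 1<2 2<h))
          edgeik (Bool.¬-not (no-twoPath 0<2 2<3 k<h edge0j))
        where
        h≡4 = last≡3⇒h≡4 3≡last
        2<h = <-trans 2<3 k<h

      -- With only edges of length at most 2, the edges 0j and ik force j = 2 and i = 1, k = 3,
      -- and the cut after vertex 3 can then only be crossed by an edge extending 13 or 02.
      short-edges-impossible : Crossing → 3 < last →
                               (∀ p q → p < q → q < h → B p q ≡ true → q < 3 + p) → ⊥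
      short-edges-impossible (crossing {i} {j} {k} 1≤i i<j j<k k<h edge0j edgeik) 3<last short
        with refl , refl ← between-1-3 1≤i i<j (short 0 j (<-trans 1≤i i<j) (<-trans j<k k<h) edge0j)
        with refl ← ≤-antisym (≤-pred (short 1 k (<-trans i<j j<k) k<h edgeik)) j<k
        with p , q , p≤3 , 3<q , q<h , edgepq ← cuts 3 (j<last⇒sj<h 3<last) = cut-after-3 p p≤3 3<q q<h edgepq
        where
        cut-after-3 : ∀ p {q} → p ≤ 3 → 3 < q → q < h → B p q ≡ true → ⊥
        cut-after-3 3 _ 3<q q<h edge3q = no-twoPath 1<3 3<q q<h edgeik edge3q
        cut-after-3 2 {q} _ 3<q q<h edge2q
          with refl ← ≤-antisym (≤-pred (short 2 q (<-trans 2<3 3<q) q<h edge2q)) 3<q =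
          no-twoPath 0<2 2<4 q<h edge0j edge2q
        cut-after-3 0 {q} _ 3<q q<h edge0q = <⇒≱ (short 0 q (≤-trans (s≤s z≤n) 3<q) q<h edge0q) (<⇒≤ 3<q)
        cut-after-3 1 {q} _ 3<q q<h edge1q = <⇒≱ (short 1 q (<-trans 1<3 3<q) q<h edge1q) 3<q
        cut-after-3 (suc (suc (suc (suc _)))) (s≤s (s≤s (s≤s ()))) _ _ _

      crossing-quadruple : Crossing → Quadruple
      crossing-quadruple (crossing 1≤i i<j j<k k<h edge0j edgeik) =
        quadruple 0 _ _ _ 1≤i i<j j<k k<h (inj₂ (edge0j , edgeik))

      result : Witness ⊎ mkOGraph h B ∈𝒥
      result with <-cmp 3 last | find-crossing
      ... | tri> _ _ last<3 | crossing 1≤i i<j j<k k<h _ _ =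
        ⊥-elim (<⇒≱ (≤-<-trans (j≤last k<h) last<3) (≤-trans (s≤s (≤-trans (s≤s 1≤i) i<j)) j<k))
      ... | tri≈ _ 3≡last _ | c = inj₂ (∈𝒥-Q₁ (last≡3⇒h≡4 3≡last) (last≡3⇒Q₁ c 3≡last))
      ... | tri< 3<last _ _ | c
        with anyUpTo? (λ q → anyUpTo? (λ p → (3 + p ≤? q) ×-dec (B p q Bool.≟ true)) q) h
      ...   | yes (q , q<h , p , p<q , 3+p≤q , edgepq) =
        inj₁ (distinctQuadruples t₀ (crossing-quadruple c)
                (quadruple p (suc p) (suc (suc p)) q ≤-refl ≤-refl 3+p≤q q<h (inj₁ edgepq))
                (0 , 3 , s≤s z≤n , ≤-refl , λ eq → false≢true (trans (sym (no-edge0k c)) (trans eq edgepq))))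
      ...   | no noLongEdge = ⊥-elim (short-edges-impossible c 3<last λ p q p<q q<h edgepq →
                              ≰⇒> λ 3+p≤q → noLongEdge (q , q<h , p , p<q , 3+p≤q , edgepq))

    result : Witness ⊎ mkOGraph h B ∈𝒥
    result with B 0 last in edge0last
    ... | true  = LastEdgePresent.result edge0last
    ... | false = LastEdgeAbsent.result edge0last

  small⇒complete : h ≤ 2 → Agrees (adj (J₁ h))
  small⇒complete h≤2 i j i<j j<h with cuts 0 (≤-trans (s≤s (≤-trans (s≤s z≤n) i<j)) j<h)
  ... | suc _ , _ , () , _
  ... | zero , q , _ , 0<q , q<h , edge0q
    with refl ← ≤-antisym (≤-pred (≤-trans q<h h≤2)) 0<q
    with refl ← ≤-antisym (≤-pred (≤-trans j<h h≤2)) (≤-trans (s≤s z≤n) i<j)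
    with refl ← n≤0⇒n≡0 (≤-pred i<j) = edge0q

  first-edge : 1 < h → ∃ λ j → 0 < j × j < h × B 0 j ≡ true
  first-edge 1<h with cuts 0 1<h
  ... | suc _ , _ , () , _
  ... | zero , j , _ , 0<j , j<h , edge0j = j , 0<j , j<h , edge0j

  first-triple : 2 < h → Triple
  first-triple 2<h with first-edge (<-trans 1<2 2<h)
  ... | j , 0<j , j<h , edge0j with m≤n⇒m<n∨m≡n 0<j
  ...   | inj₁ 1<j = triple 0 1 j 0<1 1<j j<h (inj₁ edge0j)
  ...   | inj₂ refl with cuts 1 2<h
  ...     | zero  , q , _ , 1<q , q<h , edge0q = triple 0 1 q 0<1 1<q q<h (inj₁ edge0q)
  ...     | suc zero , q , _ , 1<q , q<h , edge1q = triple 0 1 q 0<1 1<q q<h (inj₂ (edge0j , edge1q))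
  ...     | suc (suc _) , _ , s≤s () , _

  tripleProfile : Triple → Profile
  tripleProfile (triple a b c _ _ _ _) = profile a b c

  profile-≢⇒PatternsDiffer : ∀ t u → tripleProfile t ≢ tripleProfile u →
                             PatternsDiffer B (Triple.vertices t) (Triple.vertices u)
  profile-≢⇒PatternsDiffer (triple a b c _ _ _ _) (triple a′ b′ c′ _ _ _ _) profile≢
    with B a b Bool.≟ B a′ b′ | B a c Bool.≟ B a′ c′ | B b c Bool.≟ B b′ c′
  ... | no ab≢ | _      | _      = 0 , 1 , 0<1 , 1<3 , ab≢
  ... | yes _  | no ac≢ | _      = 0 , 2 , 0<2 , 2<3 , ac≢
  ... | yes _  | yes _  | no bc≢ = 1 , 2 , 1<2 , 2<3 , bc≢
  ... | yes ab | yes ac | yes bc = ⊥-elim (profile≢ (cong₂ _,_ ab (cong₂ _,_ ac bc)))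

  profiles-agree-or-witness : (t₀ : Triple) → Witness ⊎ Uniform (tripleProfile t₀)
  profiles-agree-or-witness t₀ with anyUpTo? (λ c → anyUpTo? (λ b → anyUpTo? (λ a →
      irreducible? a b c ×-dec ¬? (profile a b c ≟ᵖ tripleProfile t₀)) b) c) h
  ... | yes (c , c<h , b , b<c , a , a<b , irr , profile≢) =
    inj₁ (distinctTriples t₀ (triple a b c a<b b<c c<h irr)
           (profile-≢⇒PatternsDiffer t₀ (triple a b c a<b b<c c<h irr) λ eq → profile≢ (sym eq)))
  ... | no none = inj₂ λ a b c a<b b<c c<h irr →
    decidable-stable (profile a b c ≟ᵖ tripleProfile t₀) λ profile≢ →
      none (c , c<h , b , b<c , a , a<b , irr , profile≢)

  uniform⇒result : (t₀ : Triple) → Uniform (tripleProfile t₀) → Witness ⊎ mkOGraph h B ∈𝒥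
  uniform⇒result t₀@(triple _ _ _ _ _ _ irr) = by-profile (tripleProfile t₀) refl
    where
    by-profile : ∀ T → tripleProfile t₀ ≡ T → Uniform T → Witness ⊎ mkOGraph h B ∈𝒥
    by-profile (true  , true  , true ) _ u = inj₂ (∈𝒥-J₁ (uniform-complete u))
    by-profile (true  , false , true ) _ u = inj₂ (∈𝒥-L (uniform-path u))
    by-profile (true  , true  , false) _ u = inj₂ (∈𝒥-J₃ (uniform-starFromFirst u))
    by-profile (false , true  , true ) _ u = inj₂ (∈𝒥-J₄ (uniform-starToLast u))
    by-profile (false , true  , false) _ u = UniformJ₂.result u t₀
    by-profile (false , false , _    ) p _ = ⊥-elim (false≢true ([ trans (sym (profile-ac p)) ,
                                                                  (λ (ab , _) → trans (sym (profile-ab p)) ab) ]′ irr))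
    by-profile (true  , false , false) p _ = ⊥-elim (false≢true ([ trans (sym (profile-ac p)) ,
                                                                  (λ (_ , bc) → trans (sym (profile-bc p)) bc) ]′ irr))

  order>2 : ¬ (mkOGraph h B ∈𝒥) → 2 < h
  order>2 ∉𝒥 = ≰⇒> λ h≤2 → ∉𝒥 (∈𝒥-J₁ (small⇒complete h≤2))

  witness : ¬ (mkOGraph h B ∈𝒥) → Witness
  witness ∉𝒥 with t₀ ← first-triple (order>2 ∉𝒥) with profiles-agree-or-witness t₀
  ... | inj₁ w       = w
  ... | inj₂ uniform with uniform⇒result t₀ uniform
  ...   | inj₁ w   = w
  ...   | inj₂ inJ = ⊥-elim (∉𝒥 inJ)

  pieceFamily : ¬ (mkOGraph h B ∈𝒥) → PieceFamily B 0 h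
  pieceFamily ∉𝒥 with j , 0<j , j<h , edge0j ← first-edge (<-trans 1<2 (order>2 ∉𝒥)) =
    witness⇒PieceFamily 0<j j<h edge0j (witness ∉𝒥)

-- From the blocks of the decomposition to a chain

module Shift (A : ℕ → ℕ → Bool) (o : ℕ) where

  shifted : ℕ → ℕ → Bool
  shifted i j = A (o + i) (o + j)

  induced-shift : ∀ P {i j} → i < length P → j < length P →
                  induced A (map (o +_) P) i j ≡ induced shifted P i j
  induced-shift P i< j< = cong₂ A (!-map-+ o P i<) (!-map-+ o P j<)

  Piece-shift : ∀ {b P} → Piece shifted 0 b P → Piece A o (o + b) (map (o +_) P)
  Piece-shift {b} {P} (piece 1≤|P| inc P<b cuts) = piece
    (subst (1 ≤_) (sym |P|≡) 1≤|P|)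
    (subst (λ lo → IncreasingFrom lo (map (o +_) P)) (+-identityʳ o) (IncreasingFrom-map-+ o inc))
    (All.map⁺ (All.map (+-monoʳ-< o) P<b))
    λ g sg< → let i , j , i≤g , g<j , j< , edge = cuts g (subst (suc g <_) |P|≡ sg<) in
      i , j , i≤g , g<j , subst (j <_) (sym |P|≡) j< ,
      trans (induced-shift P (≤-<-trans i≤g (<-trans g<j j<)) j<) edge
    where
    |P|≡ : length (map (o +_) P) ≡ length P
    |P|≡ = List.length-map (o +_) P

  Distinguishable-shift : ∀ P Q → Distinguishable shifted P Q →
                          Distinguishable A (map (o +_) P) (map (o +_) Q)
  Distinguishable-shift P Q (inj₁ |P|≢|Q|) =
    inj₁ λ eq → |P|≢|Q| (trans (sym (List.length-map (o +_) P)) (trans eq (List.length-map (o +_) Q)))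
  Distinguishable-shift P Q (inj₂ (|P|≡|Q| , i , j , i<j , j< , differ)) =
    inj₂ (trans (List.length-map (o +_) P) (trans |P|≡|Q| (sym (List.length-map (o +_) Q))) ,
          i , j , i<j , subst (j <_) (sym (List.length-map (o +_) P)) j< ,
          λ eq → differ (trans (sym (induced-shift P (<-trans i<j j<) j<))
                        (trans eq (induced-shift Q (<-trans i<j j<Q) j<Q))))
    where
    j<Q = subst (j <_) |P|≡|Q| j<

  PieceFamily-shift : ∀ {b} → PieceFamily shifted 0 b → PieceFamily A o (o + b)
  PieceFamily-shift F = record
    { pieces          = map (map (o +_)) pieces
    ; valid           = All.map⁺ (All.map Piece-shift valid)
    ; distinguishable = AllPairs.map⁺ (AllPairs.map (λ {P} {Q} → Distinguishable-shift P Q) distinguishable)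
    ; ample           = λ n → subst (λ ℓs → 2 ^ n ≤ growth (suc n) ℓs) (sym lengths) (ample n) }
    where
    open PieceFamily F
    lengths : map length (map (map (o +_)) pieces) ≡ map length pieces
    lengths = trans (sym (List.map-∘ pieces)) (List.map-cong (List.length-map (o +_)) pieces)

module Extraction (G : OGraph) where

  open Chains G

  IsBlockDecomp⇒≤order : ∀ o bs → IsBlockDecomp G o bs → o ≤ order G
  IsBlockDecomp⇒≤order o []       o≡N               = ≤-reflexive o≡N
  IsBlockDecomp⇒≤order o (b ∷ bs) (_ , _ , _ , rest) =
    ≤-trans (m≤m+n o b) (IsBlockDecomp⇒≤order (o + b) bs rest)

  weaken : ∀ {lo′ lo} → lo′ ≤ lo → Chain lo → Chain lo′
  weaken _     []                                  = []
  weaken lo′≤lo (block o b lo≤o o+b≤N noEdge F ch) = block o b (≤-trans lo′≤lo lo≤o) o+b≤N noEdge F ch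

  blockCount-weaken : ∀ {lo′ lo} (lo′≤lo : lo′ ≤ lo) ch → blockCount (weaken lo′≤lo ch) ≡ blockCount ch
  blockCount-weaken _ []                     = refl
  blockCount-weaken _ (block _ _ _ _ _ _ _) = refl

  chainOfBlocks : ∀ o bs Hs → IsBlockDecomp G o bs → Hs ⊆ blocks G o bs → All (λ H → ¬ (H ∈𝒥)) Hs →
                  Σ (Chain o) λ ch → length Hs ≤ blockCount ch
  chainOfBlocks o []       []       _                          []           _             = [] , z≤n
  chainOfBlocks o (b ∷ bs) Hs       (_ , _ , _ , rest)          (_ ∷ʳ Hs⊆)   Hs∉𝒥
    with ch , |Hs|≤ ← chainOfBlocks (o + b) bs Hs rest Hs⊆ Hs∉𝒥 =
    weaken (m≤m+n o b) ch , subst (length Hs ≤_) (sym (blockCount-weaken (m≤m+n o b) ch)) |Hs|≤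
  chainOfBlocks o (b ∷ bs) (H ∷ Hs) (_ , irr , noEdge , rest) (refl ∷ Hs⊆) (H∉𝒥 ∷ Hs∉𝒥)
    with ch , |Hs|≤ ← chainOfBlocks (o + b) bs Hs rest Hs⊆ Hs∉𝒥 =
    block o b ≤-refl (IsBlockDecomp⇒≤order (o + b) bs rest) noEdge family ch , s≤s |Hs|≤
    where
    family : PieceFamily (adj G) o (o + b)
    family = Shift.PieceFamily-shift (adj G) o
      (Classification.pieceFamily b (adj H) (Irreducible⇒EveryCutCrossed H irr) H∉𝒥)

lemma5p6 : (k m : ℕ) (G : OGraph) (Gs : List OGraph) →
    IsIrreducibleBlockDecomposition G Gs → length Gs ≡ m →
    -- at least k of the blocks G_i are not in 𝒥
    Σ (List OGraph) (λ Hs → Hs ⊆ Gs × All (λ H → ¬ (H ∈𝒥)) Hs × k ≤ length Hs) →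
    (n : ℕ) → n ≤ k → 2 ^ (n ∸ 1) ≤ S n G
lemma5p6 k m G Gs (bs , decomp , refl) _ (Hs , Hs⊆Gs , Hs∉𝒥 , k≤|Hs|) n n≤k
  with ch , |Hs|≤count ← Extraction.chainOfBlocks G 0 bs Hs decomp Hs⊆Gs Hs∉𝒥 = begin
    2 ^ (n ∸ 1)              ≤⟨ selections-length n ch (≤-trans n≤k (≤-trans k≤|Hs| |Hs|≤count)) ⟩
    length (selections n ch) ≤⟨ length≤S G n _ (selections-valid n ch) (selections-distinct n ch) ⟩
    S n G                    ∎
  where
  open Chains G
  open ≤-Reasoning
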